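{- Let $(a_n)_{n\ge1}$ and $(b_n)_{n\ge0}$ be real sequences such that $a_n\in\{ -1,1\}$, $b_n\ge1$ and $b_n+a_{n+1}\ge1$ for all $n\ge1$. Define $B_n$ by $B_{ -1}=0$, $B_0=1$, $B_n=b_nB_{n-1}+a_nB_{n-2}$ ($n\ge1$), and for $k\ge0$ define $B_{k,n}$ by $B_{k,-1}=0$, $B_{k,0}=1$, $B_{k,n}=b_{k+n}B_{k,n-1}+a_{k+n}B_{k,n-2}$ ($n\ge1$). Then $$1\le B_{k,n}\le B_{k-1,n+1}\le B_{k+n}\qquad(k\ge1,\ n\ge0).$$
   Context: $B_{k,n}$ is the denominator of the finite continued fraction $b_k+\frac{a_{k+1}}{b_{k+1}}{+}\cdots{+}\frac{a_{k+n}}{b_{k+n}}$; note $B_{0,n}=B_n$. -}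

module Defs where

open import Level using (Level; _⊔_; suc)
open import Algebra.Bundles using (CommutativeRing)
open import Relation.Binary.Structures using (IsTotalOrder)
open import Data.Nat as ℕ using (ℕ; zero) renaming (suc to 1+)

-- An ordered commutative ring: a commutative ring with a total order ≤
-- (w.r.t. the ring's equality ≈) compatible with + and with products of
-- nonnegatives.  ℝ is an instance; the paper's real sequences are the case R = ℝ.
record OrderedCommutativeRing (c ℓ₁ ℓ₂ : Level) : Set (suc (c ⊔ ℓ₁ ⊔ ℓ₂)) where
  field
    commutativeRing : CommutativeRing c ℓ₁
  open CommutativeRing commutativeRing public
  infix 4 _≤_
  field
    _≤_          : Carrier → Carrier → Set ℓ₂
    isTotalOrder : IsTotalOrder _≈_ _≤_
    +-mono-≤     : ∀ {x y} z → x ≤ y → x + z ≤ y + z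
    *-nonneg     : ∀ {x y} → 0# ≤ x → 0# ≤ y → 0# ≤ x * y

module _ {c ℓ₁ ℓ₂} (R : OrderedCommutativeRing c ℓ₁ ℓ₂) where
  open OrderedCommutativeRing R

  -- B a b n = B_n ;  B_{-1} = 0 appears in the n = 1 case.
  B : (ℕ → Carrier) → (ℕ → Carrier) → ℕ → Carrier
  B a b zero = 1#
  B a b (1+ zero) = b 1 * 1# + a 1 * 0#
  B a b (1+ (1+ n)) = b (2 ℕ.+ n) * B a b (1+ n) + a (2 ℕ.+ n) * B a b n

  Bk : (ℕ → Carrier) → (ℕ → Carrier) → ℕ → ℕ → Carrier
  Bk a b k zero = 1#
  Bk a b k (1+ zero) = b (k ℕ.+ 1) * 1# + a (k ℕ.+ 1) * 0#
  Bk a b k (1+ (1+ n)) =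
    b (k ℕ.+ (2 ℕ.+ n)) * Bk a b k (1+ n) + a (k ℕ.+ (2 ℕ.+ n)) * Bk a b k n

{-# OPTIONS --safe #-}

-- A sequence x with x_{j+1} = b x_j + a x_{j-1} (the recurrence of B_{k,·}) stays
-- above a level d ≥ 0 once x_1 ≥ d and x_1 + a x_0 ≥ d: because b ≥ 1 and b + a' ≥ 1,
-- neither x_{j+1} nor x_{j+1} + a' x_j can drop below x_j + a x_{j-1} along the
-- recurrence. For x = B_{k,·} this gives B_{k,n} ≥ 1. The difference
-- B_{k-1,n+1} - B_{k,n} satisfies the same recurrence with initial values 1 and
-- b_k - 1, which gives B_{k,n} ≤ B_{k-1,n+1}; iterating it down to k = 0 gives
-- B_{k,n} ≤ B_{k+n}.

module Submission where

open import Defs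
open import Data.Product using (_×_; _,_; proj₁; proj₂)
open import Data.Sum using (_⊎_; inj₁; inj₂)
open import Data.Nat using (ℕ; _∸_; _≥_)
open import Data.Nat as ℕ using (zero; suc; s≤s; z≤n)
import Data.Nat.Properties as ℕₚ
open import Function using (_∘_)
open import Relation.Binary.Bundles using (Poset)
open import Relation.Binary.Structures using (IsTotalOrder)
open import Relation.Binary.PropositionalEquality as ≡ using (_≡_; cong)
import Relation.Binary.Reasoning.Setoid as SetoidReasoning
import Algebra.Properties.Ring as RingProperties
import Algebra.Properties.CommutativeSemigroup as CommutativeSemigroupProperties

module OrderedCommutativeRingProperties
  {c ℓ₁ ℓ₂} (R : OrderedCommutativeRing c ℓ₁ ℓ₂) where

  open OrderedCommutativeRing R
  open RingProperties ring using (-1*x≈-x; -‿involutive; [y-z]x≈yx-zx)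
  open SetoidReasoning setoid

  poset : Poset c ℓ₁ ℓ₂
  poset = record { isPartialOrder = IsTotalOrder.isPartialOrder isTotalOrder }

  open Poset poset public
    using (≤-respˡ-≈; ≤-respʳ-≈)
    renaming (refl to ≤-refl; reflexive to ≤-reflexive; trans to ≤-trans)

  x≤y⇒0≤y-x : ∀ {x y} → x ≤ y → 0# ≤ y - x
  x≤y⇒0≤y-x {x} {y} x≤y = ≤-respˡ-≈ (-‿inverseʳ x) (+-mono-≤ (- x) x≤y)

  0≤y-x⇒x≤y : ∀ {x y} → 0# ≤ y - x → x ≤ y
  0≤y-x⇒x≤y {x} {y} 0≤y-x =
    ≤-respʳ-≈ y-x+x≈y (≤-respˡ-≈ (+-identityˡ x) (+-mono-≤ x 0≤y-x))
    where
    y-x+x≈y : y - x + x ≈ y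
    y-x+x≈y = begin
      y - x + x     ≈⟨ +-assoc y (- x) x ⟩
      y + (- x + x) ≈⟨ +-congˡ (-‿inverseˡ x) ⟩
      y + 0#        ≈⟨ +-identityʳ y ⟩
      y             ∎

  -- If 1 ≤ 0 then 0 ≤ -1, and 1 = (-1)(-1) is a product of nonnegatives.
  0≤1 : 0# ≤ 1#
  0≤1 with IsTotalOrder.total isTotalOrder 0# 1#
  ... | inj₁ 0≤1 = 0≤1
  ... | inj₂ 1≤0 = ≤-respʳ-≈ -1*-1≈1 (*-nonneg 0≤-1 0≤-1)
    where
    0≤-1 : 0# ≤ - 1#
    0≤-1 = ≤-respʳ-≈ (+-identityˡ (- 1#)) (x≤y⇒0≤y-x 1≤0)
    -1*-1≈1 : - 1# * - 1# ≈ 1#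
    -1*-1≈1 = trans (-1*x≈-x (- 1#)) (-‿involutive 1#)

  x≤c*x : ∀ {c x} → 1# ≤ c → 0# ≤ x → x ≤ c * x
  x≤c*x {c} {x} 1≤c 0≤x =
    0≤y-x⇒x≤y (≤-respʳ-≈ [c-1]x≈cx-x (*-nonneg (x≤y⇒0≤y-x 1≤c) 0≤x))
    where
    [c-1]x≈cx-x : (c - 1#) * x ≈ c * x - x
    [c-1]x≈cx-x = begin
      (c - 1#) * x   ≈⟨ [y-z]x≈yx-zx x c 1# ⟩
      c * x - 1# * x ≈⟨ +-congˡ (-‿cong (*-identityˡ x)) ⟩
      c * x - x      ∎

  ≤-recurrence-step : ∀ {d x y α β α′} → 0# ≤ d → 1# ≤ β → 1# ≤ β + α′ →
                      d ≤ y → d ≤ y + α * x →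
                      d ≤ β * y + α * x × d ≤ β * y + α * x + α′ * y
  ≤-recurrence-step {d} {x} {y} {α} {β} {α′} 0≤d 1≤β 1≤β+α′ d≤y d≤y+αx =
    ≤-trans d≤y+αx (+-mono-≤ (α * x) (x≤c*x 1≤β 0≤y)) ,
    ≤-trans d≤y+αx (≤-respʳ-≈ [β+α′]y+αx≈βy+αx+α′y (+-mono-≤ (α * x) (x≤c*x 1≤β+α′ 0≤y)))
    where
    open CommutativeSemigroupProperties +-commutativeSemigroup using (xy∙z≈xz∙y)
    0≤y : 0# ≤ y
    0≤y = ≤-trans 0≤d d≤y
    [β+α′]y+αx≈βy+αx+α′y : (β + α′) * y + α * x ≈ β * y + α * x + α′ * y
    [β+α′]y+αx≈βy+αx+α′y = begin
      (β + α′) * y + α * x    ≈⟨ +-congʳ (distribʳ y β α′) ⟩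
      β * y + α′ * y + α * x  ≈⟨ xy∙z≈xz∙y (β * y) (α′ * y) (α * x) ⟩
      β * y + α * x + α′ * y  ∎

module ContinuedFractionDenominators
  {c ℓ₁ ℓ₂} (R : OrderedCommutativeRing c ℓ₁ ℓ₂)
  (a b : ℕ → OrderedCommutativeRing.Carrier R) where

  open OrderedCommutativeRing R
  open OrderedCommutativeRingProperties R
  open RingProperties ring using (-0#≈0#; -‿+-comm; x[y-z]≈xy-xz)
  open CommutativeSemigroupProperties +-commutativeSemigroup using (interchange; xy∙z≈xz∙y)
  open SetoidReasoning setoid

  -- x (1 + j) plays the role of B_{m,j} and x 0 that of B_{m,-1}.
  Solves : ℕ → (ℕ → Carrier) → Set ℓ₁
  Solves m x = ∀ j → x (suc (suc j)) ≈ b (suc j ℕ.+ m) * x (suc j) + a (suc j ℕ.+ m) * x j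

  B̂k : ℕ → ℕ → Carrier
  B̂k k zero    = 0#
  B̂k k (suc n) = Bk R a b k n

  B̂k-solves : ∀ k → Solves k (B̂k k)
  B̂k-solves k j = reflexive (≡.trans (B̂k-unfold j)
    (cong (λ i → b i * B̂k k (suc j) + a i * B̂k k j) (ℕₚ.+-comm k (suc j))))
    where
    B̂k-unfold : ∀ j →
      B̂k k (suc (suc j)) ≡ b (k ℕ.+ suc j) * B̂k k (suc j) + a (k ℕ.+ suc j) * B̂k k j
    B̂k-unfold zero    = ≡.refl
    B̂k-unfold (suc j) = ≡.refl

  solves-suc : ∀ {m x} → Solves m x → Solves (suc m) (x ∘ suc)
  solves-suc {m} {x} x-solves j = trans (x-solves (suc j))
    (reflexive (cong (λ i → b i * x (suc (suc j)) + a i * x (suc j)) (≡.sym (ℕₚ.+-suc (suc j) m))))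

  solves-difference : ∀ {m x y} → Solves m x → Solves m y → Solves m (λ j → x j - y j)
  solves-difference {m} {x} {y} x-solves y-solves j = begin
    x (suc (suc j)) - y (suc (suc j))                      ≈⟨ +-cong (x-solves j) (-‿cong (y-solves j)) ⟩
    (β * x (suc j) + α * x j) - (β * y (suc j) + α * y j)  ≈⟨ +-congˡ (-‿+-comm (β * y (suc j)) (α * y j)) ⟨
    (β * x (suc j) + α * x j) + (- (β * y (suc j)) + - (α * y j))
                                                           ≈⟨ interchange _ _ _ _ ⟩
    (β * x (suc j) - β * y (suc j)) + (α * x j - α * y j)  ≈⟨ +-cong (x[y-z]≈xy-xz β _ _) (x[y-z]≈xy-xz α _ _) ⟨
    β * (x (suc j) - y (suc j)) + α * (x j - y j)          ∎
    where
    β = b (suc j ℕ.+ m)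
    α = a (suc j ℕ.+ m)

  Bk-one≈b : ∀ k → Bk R a b k 1 ≈ b (suc k)
  Bk-one≈b k = begin
    b (k ℕ.+ 1) * 1# + a (k ℕ.+ 1) * 0#  ≈⟨ +-cong (*-identityʳ _) (zeroʳ _) ⟩
    b (k ℕ.+ 1) + 0#                     ≈⟨ +-identityʳ _ ⟩
    b (k ℕ.+ 1)                          ≡⟨ cong b (ℕₚ.+-comm k 1) ⟩
    b (suc k)                            ∎

  Bk-zero≈B : ∀ n → Bk R a b 0 n ≈ B R a b n
  Bk-zero≈B zero          = refl
  Bk-zero≈B (suc zero)    = refl
  Bk-zero≈B (suc (suc n)) = +-cong (*-congˡ (Bk-zero≈B (suc n))) (*-congˡ (Bk-zero≈B n))

  module _ (1≤b : ∀ n → n ≥ 1 → 1# ≤ b n)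
           (1≤b+a : ∀ n → n ≥ 1 → 1# ≤ b n + a (suc n)) where

    solves⇒≥ : ∀ {m x d} → Solves m x → 0# ≤ d → d ≤ x 1 → d ≤ x 1 + a (suc m) * x 0 →
               ∀ j → d ≤ x (suc j)
    solves⇒≥ {m} {x} {d} x-solves 0≤d d≤x₁ d≤x₁+ax₀ j = proj₁ (invariant j)
      where
      invariant : ∀ j → d ≤ x (suc j) × d ≤ x (suc j) + a (suc j ℕ.+ m) * x j
      invariant zero    = d≤x₁ , d≤x₁+ax₀
      invariant (suc j) with ≤-recurrence-step 0≤d (1≤b _ (s≤s z≤n)) (1≤b+a _ (s≤s z≤n))
                                               (proj₁ (invariant j)) (proj₂ (invariant j))
      ... | d≤x₂ , d≤x₂+a′x₁ =
        ≤-respʳ-≈ (sym (x-solves j)) d≤x₂ , ≤-respʳ-≈ (+-congʳ (sym (x-solves j))) d≤x₂+a′x₁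

    1≤Bk : ∀ k n → 1# ≤ Bk R a b k n
    1≤Bk k = solves⇒≥ (B̂k-solves k) 0≤1 ≤-refl (≤-reflexive (sym 1+a*0≈1))
      where
      1+a*0≈1 : 1# + a (suc k) * 0# ≈ 1#
      1+a*0≈1 = trans (+-congˡ (zeroʳ _)) (+-identityʳ 1#)

    Bk-suc≤Bk : ∀ k n → Bk R a b (suc k) n ≤ Bk R a b k (suc n)
    Bk-suc≤Bk k n = 0≤y-x⇒x≤y (solves⇒≥ D-solves ≤-refl 0≤D₁ 0≤D₁+aD₀ n)
      where
      D : ℕ → Carrier
      D j = B̂k k (suc j) - B̂k (suc k) j
      D-solves : Solves (suc k) D
      D-solves = solves-difference (solves-suc (B̂k-solves k)) (B̂k-solves (suc k))
      0≤D₁ : 0# ≤ D 1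
      0≤D₁ = x≤y⇒0≤y-x (1≤Bk k 1)
      0≤D₁+aD₀ : 0# ≤ D 1 + a (suc (suc k)) * D 0
      0≤D₁+aD₀ = ≤-respʳ-≈ rearrange (x≤y⇒0≤y-x (1≤b+a (suc k) (s≤s z≤n)))
        where
        1#-0#≈1# : 1# - 0# ≈ 1#
        1#-0#≈1# = trans (+-congˡ -0#≈0#) (+-identityʳ 1#)
        rearrange : b (suc k) + a (suc (suc k)) - 1# ≈ Bk R a b k 1 - 1# + a (suc (suc k)) * (1# - 0#)
        rearrange = begin
          b (suc k) + a (suc (suc k)) - 1#               ≈⟨ +-congʳ (+-congʳ (Bk-one≈b k)) ⟨
          Bk R a b k 1 + a (suc (suc k)) - 1#            ≈⟨ xy∙z≈xz∙y _ _ _ ⟩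
          Bk R a b k 1 - 1# + a (suc (suc k))            ≈⟨ +-congˡ (*-identityʳ _) ⟨
          Bk R a b k 1 - 1# + a (suc (suc k)) * 1#        ≈⟨ +-congˡ (*-congˡ 1#-0#≈1#) ⟨
          Bk R a b k 1 - 1# + a (suc (suc k)) * (1# - 0#) ∎

    Bk≤B : ∀ k n → Bk R a b k n ≤ B R a b (k ℕ.+ n)
    Bk≤B zero    n = ≤-reflexive (Bk-zero≈B n)
    Bk≤B (suc k) n = ≤-trans (Bk-suc≤Bk k n)
      (≤-respʳ-≈ (reflexive (cong (B R a b) (ℕₚ.+-suc k n))) (Bk≤B k (suc n)))

lemma1 : ∀ {c ℓ₁ ℓ₂} (R : OrderedCommutativeRing c ℓ₁ ℓ₂) →
    let open OrderedCommutativeRing R in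
    (a b : ℕ → Carrier) →
    (∀ n → n ≥ 1 → (a n ≈ - 1#) ⊎ (a n ≈ 1#)) →
    (∀ n → n ≥ 1 → 1# ≤ b n) →
    (∀ n → n ≥ 1 → 1# ≤ b n + a (Data.Nat.suc n)) →
    ∀ k n → k ≥ 1 →
      (1# ≤ Bk R a b k n) ×
      (Bk R a b k n ≤ Bk R a b (k ∸ 1) (Data.Nat.suc n)) ×
      (Bk R a b (k ∸ 1) (Data.Nat.suc n) ≤ B R a b (k Data.Nat.+ n))
lemma1 R a b _ 1≤b 1≤b+a (suc k) n _ =
  1≤Bk 1≤b 1≤b+a (suc k) n ,
  Bk-suc≤Bk 1≤b 1≤b+a k n ,
  ≤-respʳ-≈ (reflexive (cong (B R a b) (ℕₚ.+-suc k n))) (Bk≤B 1≤b 1≤b+a k (suc n))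
  where
  open OrderedCommutativeRing R using (reflexive)
  open OrderedCommutativeRingProperties R using (≤-respʳ-≈)
  open ContinuedFractionDenominators R a b
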